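{- Let $G$ be a graph, $v\in V(G)$, and let $H$ be obtained from $G$ by $2$-stretching $v$ (new vertices $v_0,v_1,v_2$). Suppose $a^\top x\le\beta$ is a facet of $\mathrm{STAB}(G)$ with $a\in\mathbb{R}^{V(G)}$, $a\ge0$. Let $A_1=\Gamma_H(v_1)\setminus\{v_0\}$, $A_2=\Gamma_H(v_2)\setminus\{v_0\}$, and $d_1=a_v-\beta+\max\{a^\top x: x\in\mathrm{STAB}(G), x_i=0\ \forall i\in\{v\}\cup A_2\}$, $d_2=a_v-\beta+\max\{a^\top x: x\in\mathrm{STAB}(G), x_i=0\ \forall i\in\{v\}\cup A_1\}$. If $d_1+d_2\ge a_v$, then $\sum_{i\in V(G)\setminus\{v\}}a_ix_i+d_1x_{v_1}+d_2x_{v_2}+(d_1+d_2-a_v)x_{v_0}\le\beta-a_v+d_1+d_2$ is a facet of $\mathrm{STAB}(H)$.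
   Context: All graphs are finite, simple, undirected. $\mathrm{STAB}(G)$ is the convex hull of incidence vectors of stable sets of $G$; $\Gamma_H(u)$ is the set of neighbours of $u$ in $H$. Vertex stretching with $p=2$: given $G$, $v\in V(G)$ and nonempty proper subsets $A_1,A_2$ of $\Gamma_G(v)$ with $A_1\cup A_2=\Gamma_G(v)$, the $2$-stretching of $v$ replaces $v$ by new vertices $v_0,v_1,v_2$, joins $v_1$ and $v_2$ to $v_0$, and joins $v_\ell$ to all vertices of $A_\ell$ for $\ell=1,2$ (other edges of $G-v$ kept).
   Formalization: The coefficients $a$ and $\beta$ are rational rather than real, and the points of $\mathrm{STAB}(G)$ and $\mathrm{STAB}(H)$ have rational coordinates. -}

module Defs where

open import Data.Nat using (ℕ; zero; suc)
open import Data.Fin using (Fin; zero; suc; splitAt)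
open import Data.Fin.Properties using (_≟_)
open import Data.Bool using (Bool; true; false; if_then_else_; _∨_)
open import Data.Sum using (_⊎_; inj₁; inj₂)
open import Data.Product using (Σ; _×_; _,_)
open import Relation.Nullary using (yes; no; ¬_)
open import Relation.Binary.PropositionalEquality using (_≡_)
open import Data.Rational using (ℚ; 0ℚ; 1ℚ; _+_; _-_; _*_; _≤_)

record Graph (n : ℕ) : Set where
  field
    adj    : Fin n → Fin n → Bool
    sym    : ∀ i j → adj i j ≡ adj j i
    irrefl : ∀ i → adj i i ≡ false
open Graph public

-- adjacency relations (the stretched graph is given by its adjacency)
Adj : ℕ → Set
Adj n = Fin n → Fin n → Bool

VSet : ℕ → Set
VSet n = Fin n → Bool

Vec' : ℕ → Set
Vec' n = Fin n → ℚ

sumF : ∀ {n} → (Fin n → ℚ) → ℚ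
sumF {zero}  f = 0ℚ
sumF {suc n} f = f zero + sumF (λ i → f (suc i))

dot : ∀ {n} → Vec' n → Vec' n → ℚ
dot a x = sumF (λ i → a i * x i)

IsStable : ∀ {n} → Adj n → VSet n → Set
IsStable E S = ∀ i j → S i ≡ true → S j ≡ true → E i j ≡ false

χ : ∀ {n} → VSet n → Vec' n
χ S i = if S i then 1ℚ else 0ℚ

InSTAB : ∀ {n} → Adj n → Vec' n → Set
InSTAB {n} E x =
  Σ ℕ λ m → Σ (Fin m → VSet n) λ S → Σ (Fin m → ℚ) λ μ →
    (∀ k → IsStable E (S k)) × (∀ k → 0ℚ ≤ μ k) × (sumF μ ≡ 1ℚ) ×
    (∀ i → x i ≡ sumF (λ k → μ k * χ (S k) i))

AffIndep : ∀ {n k} → (Fin k → Vec' n) → Set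
AffIndep {n} {k} p =
  ∀ (λs : Fin k → ℚ) → sumF λs ≡ 0ℚ →
    (∀ i → sumF (λ j → λs j * p j i) ≡ 0ℚ) → ∀ j → λs j ≡ 0ℚ

-- S has affine rank r (= dim S + 1): r is the maximum number of
-- affinely independent points of S
HasAffRank : ∀ {n} → (Vec' n → Set) → ℕ → Set
HasAffRank {n} S r =
  (Σ (Fin r → Vec' n) λ p → (∀ j → S (p j)) × AffIndep p) ×
  (∀ k (p : Fin k → Vec' n) → (∀ j → S (p j)) → AffIndep p → k Data.Nat.≤ r)

ValidSTAB : ∀ {n} → Adj n → Vec' n → ℚ → Set
ValidSTAB E a β = ∀ x → InSTAB E x → dot a x ≤ β

FaceSTAB : ∀ {n} → Adj n → Vec' n → ℚ → Vec' n → Set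
FaceSTAB E a β x = InSTAB E x × dot a x ≡ β

FacetSTAB : ∀ {n} → Adj n → Vec' n → ℚ → Set
FacetSTAB E a β =
  ValidSTAB E a β ×
  Σ ℕ λ r → HasAffRank (InSTAB E) (suc r) × HasAffRank (FaceSTAB E a β) r

IsMax : ∀ {n} → (Vec' n → Set) → (Vec' n → ℚ) → ℚ → Set
IsMax {n} S f m = (Σ (Vec' n) λ x → S x × f x ≡ m) × (∀ x → S x → f x ≤ m)

-- 2-stretching.  V(H) = Fin (n + 2): vertex (i ↑ˡ 2) for i ≠ v is the old
-- vertex i, (v ↑ˡ 2) is v0, (n ↑ʳ 0) is v1, (n ↑ʳ 1) is v2.

data Kind (n : ℕ) : Set where
  old : Fin n → Kind n
  k0 k1 k2 : Kind n

kind : ∀ {n} → Fin n → Fin (n Data.Nat.+ 2) → Kind n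
kind {n} v x with splitAt n x
... | inj₁ i with i ≟ v
...   | yes _ = k0
...   | no  _ = old i
kind v x | inj₂ zero = k1
kind v x | inj₂ (suc _) = k2

stretchAdjK : ∀ {n} → Adj n → VSet n → VSet n → Kind n → Kind n → Bool
stretchAdjK E A₁ A₂ (old i) (old j) = E i j
stretchAdjK E A₁ A₂ (old i) k0 = false
stretchAdjK E A₁ A₂ (old i) k1 = A₁ i
stretchAdjK E A₁ A₂ (old i) k2 = A₂ i
stretchAdjK E A₁ A₂ k0 (old j) = false
stretchAdjK E A₁ A₂ k0 k0 = false
stretchAdjK E A₁ A₂ k0 k1 = true
stretchAdjK E A₁ A₂ k0 k2 = true
stretchAdjK E A₁ A₂ k1 (old j) = A₁ j
stretchAdjK E A₁ A₂ k1 k0 = true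
stretchAdjK E A₁ A₂ k1 k1 = false
stretchAdjK E A₁ A₂ k1 k2 = false
stretchAdjK E A₁ A₂ k2 (old j) = A₂ j
stretchAdjK E A₁ A₂ k2 k0 = true
stretchAdjK E A₁ A₂ k2 k1 = false
stretchAdjK E A₁ A₂ k2 k2 = false

stretch : ∀ {n} → Graph n → Fin n → VSet n → VSet n → Adj (n Data.Nat.+ 2)
stretch G v A₁ A₂ x y = stretchAdjK (adj G) A₁ A₂ (kind v x) (kind v y)

Subset⊆ : ∀ {n} → VSet n → VSet n → Set
Subset⊆ A B = ∀ i → A i ≡ true → B i ≡ true

NonemptyProper : ∀ {n} → VSet n → VSet n → Set
NonemptyProper {n} A B =
  Subset⊆ A B × (Σ (Fin n) λ i → A i ≡ true) × (Σ (Fin n) λ i → B i ≡ true × A i ≡ false)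

StretchData : ∀ {n} → Graph n → Fin n → VSet n → VSet n → Set
StretchData G v A₁ A₂ =
  NonemptyProper A₁ (adj G v) × NonemptyProper A₂ (adj G v) ×
  (∀ i → (A₁ i ∨ A₂ i) ≡ adj G v i)

newCoeffK : ∀ {n} → Vec' n → ℚ → ℚ → ℚ → Kind n → ℚ
newCoeffK a av d₁ d₂ (old i) = a i
newCoeffK a av d₁ d₂ k0 = (d₁ + d₂) - av
newCoeffK a av d₁ d₂ k1 = d₁
newCoeffK a av d₁ d₂ k2 = d₂

newCoeff : ∀ {n} → Fin n → Vec' n → ℚ → ℚ → Vec' (n Data.Nat.+ 2)
newCoeff v a d₁ d₂ x = newCoeffK a (a v) d₁ d₂ (kind v x)

STABAvoid : ∀ {n} → Graph n → Fin n → VSet n → Vec' n → Set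
STABAvoid G v B x = InSTAB (adj G) x × x v ≡ 0ℚ × (∀ i → B i ≡ true → x i ≡ 0ℚ)

{-# OPTIONS --safe #-}
-- A stable set of the stretched graph H meets {v₀, v₁, v₂} in ∅, {v₀}, {v₁}, {v₂} or {v₁, v₂}.
-- Dropping the new vertices, and adding v in the last case, leaves a stable set of G that
-- avoids A₁ if v₁ was present and A₂ if v₂ was; in each case the definitions of d₁ and d₂ are
-- exactly what makes the new inequality hold. For the dimension count, the facet of the
-- full-dimensional STAB(G) contains n affinely independent points y. Their lifts
-- x_{v₀} = 1 − y_v, x_{v₁} = x_{v₂} = y_v, together with the two maximisers defining d₁ and d₂
-- extended by x_{v₂} = 1 resp. x_{v₁} = 1, are n + 2 affinely independent points on the new
-- face. Since the right-hand side is nonzero, the origin can be added to them, so the face has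
-- dimension n + 1 = dim STAB(H) − 1.
module Submission where

open import Defs hiding (sym)
open import Data.Nat using (ℕ)
open import Data.Fin using (Fin)
open import Data.Rational using (ℚ; 0ℚ; _+_; _-_; _≤_)

open import Level using (0ℓ)
open import Algebra.Bundles using (CommutativeRing)
open import Data.Bool using (Bool; true; false; not; _∧_; _∨_; if_then_else_)
open import Data.Bool.Properties using (not-¬)
open import Data.Fin as Fin using (zero; suc; punchIn; _↑ˡ_; _↑ʳ_)
import Data.Fin.Properties as FinP
open import Data.Nat as ℕ using (zero; suc; z≤n; s≤s)
import Data.Nat.Properties as ℕP
open import Data.Product using (Σ; _×_; _,_; proj₁; proj₂)
open import Data.Rational as ℚ using (1ℚ; _*_; -_; 1/_)
import Data.Rational.Properties as ℚP
open import Data.Sum using (_⊎_; inj₁; inj₂)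
open import Data.Vec.Functional using (_∷_; insertAt; updateAt)
open import Data.Vec.Functional.Properties
  using (insertAt-lookup; insertAt-punchIn; updateAt-updates; updateAt-minimal)
open import Function using (_∘_; const)
open import Relation.Binary.PropositionalEquality
open import Relation.Nullary using (yes; no; does; contradiction)
open import Relation.Nullary.Decidable using (dec-true; dec-false)
open import Relation.Nullary.Decidable.Core using (dec⇒maybe)
open import Tactic.RingSolver using (solve-∀)
open import Tactic.RingSolver.Core.AlmostCommutativeRing
  using (AlmostCommutativeRing; fromCommutativeRing)
open import Algebra.Properties.Semiring.Sum (CommutativeRing.semiring ℚP.+-*-commutativeRing)
  using (sum; sum-replicate-zero; ∑-distrib-+; ∑-comm; *-distribˡ-sum; sum-remove)
open import Algebra.Properties.Group ℚP.+-0-group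
  using () renaming (x∙y⁻¹≈ε⇒x≈y to p-q≡0⇒p≡q; ∙-cancelʳ to +-cancelʳ)

ℚ-ring : AlmostCommutativeRing 0ℓ 0ℓ
ℚ-ring = fromCommutativeRing ℚP.+-*-commutativeRing (λ q → dec⇒maybe (0ℚ ℚP.≟ q))

p*q≡0⇒p≡0 : ∀ {p q : ℚ} → q ≢ 0ℚ → p * q ≡ 0ℚ → p ≡ 0ℚ
p*q≡0⇒p≡0 {p} {q} q≢0 pq≡0 = begin
  p                ≡⟨ sym (ℚP.*-identityʳ p) ⟩
  p * 1ℚ           ≡⟨ cong (p *_) (sym (ℚP.*-inverseʳ q)) ⟩
  p * (q * 1/ q)   ≡⟨ sym (ℚP.*-assoc p q (1/ q)) ⟩
  (p * q) * 1/ q   ≡⟨ cong (_* 1/ q) pq≡0 ⟩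
  0ℚ * 1/ q        ≡⟨ ℚP.*-zeroˡ (1/ q) ⟩
  0ℚ               ∎
  where
  open ≡-Reasoning
  instance
    q-nonZero : ℚ.NonZero q
    q-nonZero = ℚ.≢-nonZero q≢0

-- Finite sums

sumF≡sum : ∀ {n} (f : Fin n → ℚ) → sumF f ≡ sum f
sumF≡sum {zero}  f = refl
sumF≡sum {suc n} f = cong (f zero +_) (sumF≡sum (f ∘ suc))

sumF-cong : ∀ {n} {f g : Fin n → ℚ} → (∀ i → f i ≡ g i) → sumF f ≡ sumF g
sumF-cong {zero}  f≗g = refl
sumF-cong {suc n} f≗g = cong₂ _+_ (f≗g zero) (sumF-cong (f≗g ∘ suc))

sumF-zero : ∀ n → sumF {n} (const 0ℚ) ≡ 0ℚ
sumF-zero n = trans (sumF≡sum {n} (const 0ℚ)) (sum-replicate-zero n)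

sumF-*-0 : ∀ {k} (μ : Fin k → ℚ) → sumF (λ j → μ j * 0ℚ) ≡ 0ℚ
sumF-*-0 {k} μ = trans (sumF-cong (ℚP.*-zeroʳ ∘ μ)) (sumF-zero k)

sumF-+ : ∀ {n} (f g : Fin n → ℚ) → sumF (λ i → f i + g i) ≡ sumF f + sumF g
sumF-+ f g = begin
  sumF (λ i → f i + g i)  ≡⟨ sumF≡sum (λ i → f i + g i) ⟩
  sum (λ i → f i + g i)   ≡⟨ ∑-distrib-+ f g ⟩
  sum f + sum g           ≡⟨ sym (cong₂ _+_ (sumF≡sum f) (sumF≡sum g)) ⟩
  sumF f + sumF g         ∎
  where open ≡-Reasoning

sumF-*ˡ : ∀ {n} (c : ℚ) (f : Fin n → ℚ) → sumF (λ i → c * f i) ≡ c * sumF f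
sumF-*ˡ c f = begin
  sumF (λ i → c * f i)  ≡⟨ sumF≡sum (λ i → c * f i) ⟩
  sum (λ i → c * f i)   ≡⟨ sym (*-distribˡ-sum c f) ⟩
  c * sum f             ≡⟨ cong (c *_) (sym (sumF≡sum f)) ⟩
  c * sumF f            ∎
  where open ≡-Reasoning

sumF-*ʳ : ∀ {n} (c : ℚ) (f : Fin n → ℚ) → sumF (λ i → f i * c) ≡ sumF f * c
sumF-*ʳ c f = begin
  sumF (λ i → f i * c)  ≡⟨ sumF-cong (λ i → ℚP.*-comm (f i) c) ⟩
  sumF (λ i → c * f i)  ≡⟨ sumF-*ˡ c f ⟩
  c * sumF f            ≡⟨ ℚP.*-comm c (sumF f) ⟩
  sumF f * c            ∎
  where open ≡-Reasoning

sumF-comm : ∀ {m n} (f : Fin m → Fin n → ℚ) →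
  sumF (λ i → sumF (f i)) ≡ sumF (λ j → sumF (λ i → f i j))
sumF-comm f = begin
  sumF (λ i → sumF (f i))             ≡⟨ sumF-cong (λ i → sumF≡sum (f i)) ⟩
  sumF (λ i → sum (f i))              ≡⟨ sumF≡sum (λ i → sum (f i)) ⟩
  sum (λ i → sum (f i))               ≡⟨ ∑-comm f ⟩
  sum (λ j → sum (λ i → f i j))       ≡⟨ sym (sumF≡sum (λ j → sum (λ i → f i j))) ⟩
  sumF (λ j → sum (λ i → f i j))      ≡⟨ sumF-cong (λ j → sym (sumF≡sum (λ i → f i j))) ⟩
  sumF (λ j → sumF (λ i → f i j))     ∎
  where open ≡-Reasoning

sumF-mono : ∀ {n} {f g : Fin n → ℚ} → (∀ i → f i ≤ g i) → sumF f ≤ sumF g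
sumF-mono {zero}  f≤g = ℚP.≤-refl
sumF-mono {suc n} f≤g = ℚP.+-mono-≤ (f≤g zero) (sumF-mono (f≤g ∘ suc))

sumF-remove : ∀ {n} (i : Fin (suc n)) (f : Fin (suc n) → ℚ) →
  sumF f ≡ f i + sumF (f ∘ punchIn i)
sumF-remove i f = begin
  sumF f                       ≡⟨ sumF≡sum f ⟩
  sum f                        ≡⟨ sum-remove f ⟩
  f i + sum (f ∘ punchIn i)    ≡⟨ cong (f i +_) (sym (sumF≡sum (f ∘ punchIn i))) ⟩
  f i + sumF (f ∘ punchIn i)   ∎
  where open ≡-Reasoning

sumF-single : ∀ {n} (i : Fin n) (f : Fin n → ℚ) → (∀ j → j ≢ i → f j ≡ 0ℚ) → sumF f ≡ f i
sumF-single {suc n} i f f≡0 = begin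
  sumF f                       ≡⟨ sumF-remove i f ⟩
  f i + sumF (f ∘ punchIn i)   ≡⟨ cong (f i +_) (sumF-cong (λ j → f≡0 _ (FinP.punchInᵢ≢i i j))) ⟩
  f i + sumF {n} (const 0ℚ)    ≡⟨ cong (f i +_) (sumF-zero n) ⟩
  f i + 0ℚ                     ≡⟨ ℚP.+-identityʳ (f i) ⟩
  f i                          ∎
  where open ≡-Reasoning

sumF-update : ∀ {n} (i : Fin n) (f g : Fin n → ℚ) → (∀ j → j ≢ i → f j ≡ g j) →
  sumF f + g i ≡ sumF g + f i
sumF-update {suc n} i f g f≗g = begin
  sumF f + g i                          ≡⟨ cong (_+ g i) (sumF-remove i f) ⟩
  (f i + sumF (f ∘ punchIn i)) + g i    ≡⟨ cong (λ s → (f i + s) + g i) (sumF-cong f≗g′) ⟩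
  (f i + sumF (g ∘ punchIn i)) + g i    ≡⟨ swap (f i) _ (g i) ⟩
  (g i + sumF (g ∘ punchIn i)) + f i    ≡⟨ cong (_+ f i) (sym (sumF-remove i g)) ⟩
  sumF g + f i                          ∎
  where
  open ≡-Reasoning
  f≗g′ : ∀ j → f (punchIn i j) ≡ g (punchIn i j)
  f≗g′ j = f≗g _ (FinP.punchInᵢ≢i i j)
  swap : ∀ x s y → (x + s) + y ≡ (y + s) + x
  swap = solve-∀ ℚ-ring

sumF-↑ : ∀ {n m} (f : Fin (n ℕ.+ m) → ℚ) →
  sumF f ≡ sumF (λ i → f (i ↑ˡ m)) + sumF (λ j → f (n ↑ʳ j))
sumF-↑ {zero}  f = sym (ℚP.+-identityˡ _)
sumF-↑ {suc n} {m} f = trans (cong (f zero +_) (sumF-↑ {n} {m} (f ∘ suc)))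
  (sym (ℚP.+-assoc (f zero) (sumF (λ i → f (suc (i ↑ˡ m)))) (sumF (λ j → f (suc (n ↑ʳ j))))))

sumF-insertAt : ∀ {k} (xs : Fin k → ℚ) (p : Fin (suc k)) (t : ℚ) (g : Fin (suc k) → ℚ) →
  sumF (λ j → insertAt xs p t j * g j) ≡ t * g p + sumF (λ j → xs j * g (punchIn p j))
sumF-insertAt xs p t g = begin
  sumF (λ j → insertAt xs p t j * g j)
    ≡⟨ sumF-remove p (λ j → insertAt xs p t j * g j) ⟩
  insertAt xs p t p * g p + sumF (λ j → insertAt xs p t (punchIn p j) * g (punchIn p j))
    ≡⟨ cong₂ _+_ (cong (_* g p) (insertAt-lookup xs p t))
                 (sumF-cong (λ j → cong (_* g (punchIn p j)) (insertAt-punchIn xs p t j))) ⟩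
  t * g p + sumF (λ j → xs j * g (punchIn p j))
    ∎
  where open ≡-Reasoning

sumF-*-linear : ∀ {k} (μ f g : Fin k → ℚ) (x y : ℚ) →
  sumF (λ j → μ j * (x * f j + y * g j)) ≡
  x * sumF (λ j → μ j * f j) + y * sumF (λ j → μ j * g j)
sumF-*-linear μ f g x y = begin
  sumF (λ j → μ j * (x * f j + y * g j))
    ≡⟨ sumF-cong (λ j → distrib (μ j) (f j) (g j) x y) ⟩
  sumF (λ j → x * (μ j * f j) + y * (μ j * g j))
    ≡⟨ sumF-+ (λ j → x * (μ j * f j)) (λ j → y * (μ j * g j)) ⟩
  sumF (λ j → x * (μ j * f j)) + sumF (λ j → y * (μ j * g j))
    ≡⟨ cong₂ _+_ (sumF-*ˡ x (λ j → μ j * f j)) (sumF-*ˡ y (λ j → μ j * g j)) ⟩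
  x * sumF (λ j → μ j * f j) + y * sumF (λ j → μ j * g j)
    ∎
  where
  open ≡-Reasoning
  distrib : ∀ m a b x y → m * (x * a + y * b) ≡ x * (m * a) + y * (m * b)
  distrib = solve-∀ ℚ-ring

sumF-*-complement : ∀ {k} (μ f : Fin k → ℚ) →
  sumF (λ j → μ j * (1ℚ - f j)) ≡ sumF μ - sumF (λ j → μ j * f j)
sumF-*-complement μ f = begin
  sumF (λ j → μ j * (1ℚ - f j))
    ≡⟨ sumF-cong (λ j → complement (μ j) (f j)) ⟩
  sumF (λ j → μ j * (1ℚ * 1ℚ + (- 1ℚ) * f j))
    ≡⟨ sumF-*-linear μ (const 1ℚ) f 1ℚ (- 1ℚ) ⟩
  1ℚ * sumF (λ j → μ j * 1ℚ) + (- 1ℚ) * sumF (λ j → μ j * f j)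
    ≡⟨ cong (λ s → 1ℚ * s + (- 1ℚ) * sumF (λ j → μ j * f j)) (sumF-cong (ℚP.*-identityʳ ∘ μ)) ⟩
  1ℚ * sumF μ + (- 1ℚ) * sumF (λ j → μ j * f j)
    ≡⟨ normalise (sumF μ) _ ⟩
  sumF μ - sumF (λ j → μ j * f j)
    ∎
  where
  open ≡-Reasoning
  complement : ∀ m a → m * (1ℚ - a) ≡ m * (1ℚ * 1ℚ + (- 1ℚ) * a)
  complement = solve-∀ ℚ-ring
  normalise : ∀ s t → 1ℚ * s + (- 1ℚ) * t ≡ s - t
  normalise = solve-∀ ℚ-ring

dot-convex : ∀ {m k} (c : Vec' m) (μ : Fin k → ℚ) (y : Fin k → Vec' m) →
  dot c (λ i → sumF (λ j → μ j * y j i)) ≡ sumF (λ j → μ j * dot c (y j))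
dot-convex c μ y = begin
  sumF (λ i → c i * sumF (λ j → μ j * y j i))
    ≡⟨ sumF-cong (λ i → sym (sumF-*ˡ (c i) (λ j → μ j * y j i))) ⟩
  sumF (λ i → sumF (λ j → c i * (μ j * y j i)))
    ≡⟨ sumF-comm (λ i j → c i * (μ j * y j i)) ⟩
  sumF (λ j → sumF (λ i → c i * (μ j * y j i)))
    ≡⟨ sumF-cong (λ j → sumF-cong (λ i → exchange (c i) (μ j) (y j i))) ⟩
  sumF (λ j → sumF (λ i → μ j * (c i * y j i)))
    ≡⟨ sumF-cong (λ j → sumF-*ˡ (μ j) (λ i → c i * y j i)) ⟩
  sumF (λ j → μ j * dot c (y j))
    ∎
  where
  open ≡-Reasoning
  exchange : ∀ a b x → a * (b * x) ≡ b * (a * x)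
  exchange = solve-∀ ℚ-ring

dot-zero : ∀ {m} (c : Vec' m) → dot c (const 0ℚ) ≡ 0ℚ
dot-zero {m} c = trans (sumF-cong (ℚP.*-zeroʳ ∘ c)) (sumF-zero m)

-- Affine independence

TrivialKernel : ∀ {e k} → (Fin e → Fin k → ℚ) → Set
TrivialKernel {k = k} M =
  ∀ (λs : Fin k → ℚ) → (∀ i → sumF (λ j → λs j * M i j) ≡ 0ℚ) → ∀ j → λs j ≡ 0ℚ

module Elimination {e k} (M : Fin (suc e) → Fin (suc k) → ℚ) (p : Fin (suc k))
                   (pivot≢0 : M zero p ≢ 0ℚ) where

  open ≡-Reasoning

  pivot : ℚ
  pivot = M zero p

  pairing : (Fin k → ℚ) → (Fin (suc k) → ℚ) → ℚ
  pairing μ g = sumF (λ j → μ j * g (punchIn p j))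

  reduced : Fin e → Fin k → ℚ
  reduced i j = pivot * M (suc i) (punchIn p j) + (- M (suc i) p) * M zero (punchIn p j)

  extend : (Fin k → ℚ) → Fin (suc k) → ℚ
  extend μ = insertAt (λ j → pivot * μ j) p (- pairing μ (M zero))

  extend-pairing : ∀ μ g →
    sumF (λ j → extend μ j * g j) ≡ pivot * pairing μ g + (- pairing μ (M zero)) * g p
  extend-pairing μ g = begin
    sumF (λ j → extend μ j * g j)
      ≡⟨ sumF-insertAt (λ j → pivot * μ j) p (- R) g ⟩
    (- R) * g p + sumF (λ j → (pivot * μ j) * g (punchIn p j))
      ≡⟨ cong ((- R) * g p +_) (trans (sumF-cong (λ j → ℚP.*-assoc pivot (μ j) (g (punchIn p j))))
                                      (sumF-*ˡ pivot (λ j → μ j * g (punchIn p j)))) ⟩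
    (- R) * g p + pivot * pairing μ g
      ≡⟨ ℚP.+-comm ((- R) * g p) (pivot * pairing μ g) ⟩
    pivot * pairing μ g + (- R) * g p
      ∎
    where
    R = pairing μ (M zero)

  extend-kernel : ∀ μ → (∀ i → sumF (λ j → μ j * reduced i j) ≡ 0ℚ) →
    ∀ i → sumF (λ j → extend μ j * M i j) ≡ 0ℚ
  extend-kernel μ μ∈ker zero = trans (extend-pairing μ (M zero)) (cancel pivot (pairing μ (M zero)))
    where
    cancel : ∀ c r → c * r + (- r) * c ≡ 0ℚ
    cancel = solve-∀ ℚ-ring
  extend-kernel μ μ∈ker (suc i) = begin
    sumF (λ j → extend μ j * M (suc i) j)
      ≡⟨ extend-pairing μ (M (suc i)) ⟩
    pivot * S + (- R) * M (suc i) p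
      ≡⟨ exchange pivot S R (M (suc i) p) ⟩
    pivot * S + (- M (suc i) p) * R
      ≡⟨ sym (sumF-*-linear μ (M (suc i) ∘ punchIn p) (M zero ∘ punchIn p) pivot (- M (suc i) p)) ⟩
    sumF (λ j → μ j * reduced i j)
      ≡⟨ μ∈ker i ⟩
    0ℚ ∎
    where
    S = pairing μ (M (suc i))
    R = pairing μ (M zero)
    exchange : ∀ c s r m → c * s + (- r) * m ≡ c * s + (- m) * r
    exchange = solve-∀ ℚ-ring

  reduced-trivialKernel : TrivialKernel M → TrivialKernel reduced
  reduced-trivialKernel ker μ μ∈ker j = p*q≡0⇒p≡0 pivot≢0 (begin
    μ j * pivot                ≡⟨ ℚP.*-comm (μ j) pivot ⟩
    pivot * μ j                ≡⟨ sym (insertAt-punchIn (λ j → pivot * μ j) p (- pairing μ (M zero)) j) ⟩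
    extend μ (punchIn p j)     ≡⟨ ker (extend μ) (extend-kernel μ μ∈ker) (punchIn p j) ⟩
    0ℚ                         ∎)

-- Gaussian elimination: a zero first row is dropped, otherwise a pivot in it eliminates one unknown.
trivialKernel⇒≤ : ∀ {e k} (M : Fin e → Fin k → ℚ) → TrivialKernel M → k ℕ.≤ e
trivialKernel⇒≤ {k = zero} M ker = z≤n
trivialKernel⇒≤ {zero} {suc k} M ker = contradiction (ker (const 1ℚ) (λ ()) zero) (λ ())
trivialKernel⇒≤ {suc e} {suc k} M ker with FinP.all? (λ j → M zero j ℚP.≟ 0ℚ)
... | yes row≡0 = ℕP.m≤n⇒m≤1+n (trivialKernel⇒≤ (M ∘ suc) ker′)
  where
  ker′ : TrivialKernel (M ∘ suc)
  ker′ λs λs∈ker = ker λs λ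
    { zero    → trans (sumF-cong (λ j → trans (cong (λs j *_) (row≡0 j)) (ℚP.*-zeroʳ (λs j))))
                      (sumF-zero (suc k))
    ; (suc i) → λs∈ker i
    }
... | no row≢0 with FinP.¬∀⟶∃¬ _ _ (λ j → M zero j ℚP.≟ 0ℚ) row≢0
...   | p , pivot≢0 = s≤s (trivialKernel⇒≤ reduced (reduced-trivialKernel ker))
  where open Elimination M p pivot≢0

affIndep⇒≤ : ∀ {d k} (p : Fin k → Vec' d) → AffIndep p → k ℕ.≤ suc d
affIndep⇒≤ p indep = trivialKernel⇒≤ homogenised ker
  where
  homogenised : Fin (suc _) → Fin _ → ℚ
  homogenised = const 1ℚ ∷ λ i j → p j i
  ker : TrivialKernel homogenised
  ker λs λs∈ker = indep λs (trans (sumF-cong (sym ∘ ℚP.*-identityʳ ∘ λs)) (λs∈ker zero)) (λs∈ker ∘ suc)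

origin∷-affIndep : ∀ {m k} {c : Vec' m} {b : ℚ} (p : Fin k → Vec' m) →
  (∀ j → dot c (p j) ≡ b) → b ≢ 0ℚ → AffIndep p → AffIndep (const 0ℚ ∷ p)
origin∷-affIndep {c = c} {b} p on-hyperplane b≢0 indep λs Σλ≡0 λs∈ker = λ
  { zero    → λ₀≡0
  ; (suc j) → indep λ′ Σλ′≡0 λ′∈ker j
  }
  where
  open ≡-Reasoning
  λ′ : Fin _ → ℚ
  λ′ = λs ∘ suc
  λ′∈ker : ∀ i → sumF (λ j → λ′ j * p j i) ≡ 0ℚ
  λ′∈ker i = trans (sym (drop (λs zero) _)) (λs∈ker i)
    where
    drop : ∀ x s → x * 0ℚ + s ≡ s
    drop = solve-∀ ℚ-ring
  Σλ′≡0 : sumF λ′ ≡ 0ℚ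
  Σλ′≡0 = p*q≡0⇒p≡0 b≢0 (begin
    sumF λ′ * b                              ≡⟨ sym (sumF-*ʳ b λ′) ⟩
    sumF (λ j → λ′ j * b)                    ≡⟨ sumF-cong (λ j → cong (λ′ j *_) (sym (on-hyperplane j))) ⟩
    sumF (λ j → λ′ j * dot c (p j))          ≡⟨ sym (dot-convex c λ′ p) ⟩
    dot c (λ i → sumF (λ j → λ′ j * p j i))  ≡⟨ sumF-cong (λ i → cong (c i *_) (λ′∈ker i)) ⟩
    dot c (const 0ℚ)                         ≡⟨ dot-zero c ⟩
    0ℚ                                       ∎)
  λ₀≡0 : λs zero ≡ 0ℚ
  λ₀≡0 = begin
    λs zero              ≡⟨ sym (ℚP.+-identityʳ (λs zero)) ⟩
    λs zero + 0ℚ         ≡⟨ cong (λs zero +_) (sym Σλ′≡0) ⟩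
    λs zero + sumF λ′    ≡⟨ Σλ≡0 ⟩
    0ℚ                   ∎

HasAffRank-unique : ∀ {m} {S : Vec' m → Set} {r r′} → HasAffRank S r → HasAffRank S r′ → r ≡ r′
HasAffRank-unique ((p , p∈S , p-indep) , ≤r) ((q , q∈S , q-indep) , ≤r′) =
  ℕP.≤-antisym (≤r′ _ p p∈S p-indep) (≤r _ q q∈S q-indep)

-- Stable set polytopes

𝟙 : Bool → ℚ
𝟙 b = if b then 1ℚ else 0ℚ

𝟙-not : ∀ b → 𝟙 (not b) ≡ 1ℚ - 𝟙 b
𝟙-not false = refl
𝟙-not true  = refl

module _ {m} {E : Adj m} where

  χ∈STAB : ∀ {S} → IsStable E S → InSTAB E (χ S)
  χ∈STAB {S} S-stable =
    1 , const S , const 1ℚ , const S-stable , const (ℚP.nonNegative⁻¹ 1ℚ) , refl ,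
    λ i → sym (trans (ℚP.+-identityʳ _) (ℚP.*-identityˡ _))

  0∈STAB : InSTAB E (const 0ℚ)
  0∈STAB = χ∈STAB {S = const false} (λ i j ())

  ValidSTAB-from-stable : ∀ {c b} → (∀ S → IsStable E S → dot c (χ S) ≤ b) → ValidSTAB E c b
  ValidSTAB-from-stable {c} {b} stable-valid x (k , S , μ , S-stable , μ≥0 , Σμ≡1 , x≡) =
    let open ℚP.≤-Reasoning in begin
    dot c x                                     ≡⟨ sumF-cong (λ i → cong (c i *_) (x≡ i)) ⟩
    dot c (λ i → sumF (λ j → μ j * χ (S j) i))  ≡⟨ dot-convex c μ (χ ∘ S) ⟩
    sumF (λ j → μ j * dot c (χ (S j)))          ≤⟨ sumF-mono weighted ⟩
    sumF (λ j → μ j * b)                        ≡⟨ sumF-*ʳ b μ ⟩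
    sumF μ * b                                  ≡⟨ cong (_* b) Σμ≡1 ⟩
    1ℚ * b                                      ≡⟨ ℚP.*-identityˡ b ⟩
    b                                           ∎
    where
    weighted : ∀ j → μ j * dot c (χ (S j)) ≤ μ j * b
    weighted j = ℚP.*-monoˡ-≤-nonNeg (μ j) {{ℚ.nonNegative (μ≥0 j)}} (stable-valid (S j) (S-stable j))

  ValidSTAB⇒0≤rhs : ∀ {c b} → ValidSTAB E c b → 0ℚ ≤ b
  ValidSTAB⇒0≤rhs {c} valid = subst (_≤ _) (dot-zero c) (valid (const 0ℚ) 0∈STAB)

  facet-criterion : ∀ {c b k} → ValidSTAB E c b → b ≢ 0ℚ →
    (p : Fin k → Vec' m) → (∀ j → FaceSTAB E c b (p j)) → AffIndep p → k ≡ m →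
    FacetSTAB E c b
  facet-criterion {c} {b} valid b≢0 p p∈F p-indep refl =
    valid , _ ,
    ((const 0ℚ ∷ p , origin∷p∈STAB , origin∷-affIndep {c = c} p (proj₂ ∘ p∈F) b≢0 p-indep) ,
     λ _ q _ q-indep → affIndep⇒≤ q q-indep) ,
    ((p , p∈F , p-indep) , face-bound)
    where
    origin∷p∈STAB : ∀ j → InSTAB E ((const 0ℚ ∷ p) j)
    origin∷p∈STAB zero    = 0∈STAB
    origin∷p∈STAB (suc j) = proj₁ (p∈F j)
    face-bound : ∀ k′ (q : Fin k′ → Vec' m) → (∀ j → FaceSTAB E c b (q j)) → AffIndep q → k′ ℕ.≤ m
    face-bound _ q q∈F q-indep =
      ℕP.≤-pred (affIndep⇒≤ (const 0ℚ ∷ q) (origin∷-affIndep {c = c} q (proj₂ ∘ q∈F) b≢0 q-indep))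

⁅_⁆ : ∀ {m} → Fin m → VSet m
⁅ u ⁆ i = does (u Fin.≟ i)

χ⁅⁆-self : ∀ {m} (u : Fin m) → χ ⁅ u ⁆ u ≡ 1ℚ
χ⁅⁆-self u = cong 𝟙 (dec-true (u Fin.≟ u) refl)

χ⁅⁆-other : ∀ {m} {u i : Fin m} → i ≢ u → χ ⁅ u ⁆ i ≡ 0ℚ
χ⁅⁆-other i≢u = cong 𝟙 (dec-false (_ Fin.≟ _) (i≢u ∘ sym))

dot-χ⁅⁆ : ∀ {m} (a : Vec' m) (u : Fin m) → dot a (χ ⁅ u ⁆) ≡ a u
dot-χ⁅⁆ a u = begin
  dot a (χ ⁅ u ⁆)   ≡⟨ sumF-single u (λ i → a i * χ ⁅ u ⁆ i) off-u ⟩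
  a u * χ ⁅ u ⁆ u   ≡⟨ cong (a u *_) (χ⁅⁆-self u) ⟩
  a u * 1ℚ          ≡⟨ ℚP.*-identityʳ (a u) ⟩
  a u               ∎
  where
  open ≡-Reasoning
  off-u : ∀ i → i ≢ u → a i * χ ⁅ u ⁆ i ≡ 0ℚ
  off-u i i≢u = trans (cong (a i *_) (χ⁅⁆-other i≢u)) (ℚP.*-zeroʳ (a i))

module _ {m} (G : Graph m) where

  open ≡-Reasoning

  ⁅⁆-stable : ∀ u → IsStable (adj G) ⁅ u ⁆
  ⁅⁆-stable u i j u≡i u≡j with u Fin.≟ i | u Fin.≟ j
  ... | yes refl | yes refl = irrefl G u

  units : Fin (suc m) → Vec' m
  units = const 0ℚ ∷ χ ∘ ⁅_⁆

  units-affIndep : AffIndep units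
  units-affIndep λs Σλ≡0 λs∈ker = λ
    { zero    → λ₀≡0
    ; (suc u) → λ′≡0 u
    }
    where
    λ′≡0 : ∀ u → λs (suc u) ≡ 0ℚ
    λ′≡0 u = begin
      λs (suc u)
        ≡⟨ pad (λs zero) (λs (suc u)) ⟩
      λs zero * 0ℚ + λs (suc u) * 1ℚ
        ≡⟨ cong (λ x → λs zero * 0ℚ + λs (suc u) * x) (sym (χ⁅⁆-self u)) ⟩
      λs zero * 0ℚ + λs (suc u) * χ ⁅ u ⁆ u
        ≡⟨ cong (λs zero * 0ℚ +_) (sym (sumF-single u (λ j → λs (suc j) * χ ⁅ j ⁆ u) off-u)) ⟩
      λs zero * 0ℚ + sumF (λ j → λs (suc j) * χ ⁅ j ⁆ u)
        ≡⟨ λs∈ker u ⟩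
      0ℚ
        ∎
      where
      pad : ∀ x y → y ≡ x * 0ℚ + y * 1ℚ
      pad = solve-∀ ℚ-ring
      off-u : ∀ j → j ≢ u → λs (suc j) * χ ⁅ j ⁆ u ≡ 0ℚ
      off-u j j≢u = trans (cong (λs (suc j) *_) (χ⁅⁆-other (j≢u ∘ sym))) (ℚP.*-zeroʳ (λs (suc j)))
    λ₀≡0 : λs zero ≡ 0ℚ
    λ₀≡0 = begin
      λs zero                        ≡⟨ sym (ℚP.+-identityʳ _) ⟩
      λs zero + 0ℚ                   ≡⟨ cong (λs zero +_) (sym (trans (sumF-cong λ′≡0) (sumF-zero m))) ⟩
      λs zero + sumF (λs ∘ suc)      ≡⟨ Σλ≡0 ⟩
      0ℚ                             ∎

  STAB-fullDimensional : HasAffRank (InSTAB (adj G)) (suc m)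
  STAB-fullDimensional = (units , units∈STAB , units-affIndep) , λ _ p _ → affIndep⇒≤ p
    where
    units∈STAB : ∀ j → InSTAB (adj G) (units j)
    units∈STAB zero    = 0∈STAB
    units∈STAB (suc u) = χ∈STAB (⁅⁆-stable u)

  facet-face-basis : ∀ {a β} → FacetSTAB (adj G) a β →
    Σ (Fin m → Vec' m) λ p → (∀ j → FaceSTAB (adj G) a β (p j)) × AffIndep p
  facet-face-basis {a} {β} (_ , r , STAB-rank , ((p , p∈F , p-indep) , _)) =
    subst (λ k → Σ (Fin k → Vec' m) λ q → (∀ j → FaceSTAB (adj G) a β (q j)) × AffIndep q)
          (ℕP.suc-injective (HasAffRank-unique {S = InSTAB (adj G)} STAB-rank STAB-fullDimensional))
          (p , p∈F , p-indep)

  -- For β = 0 nonnegativity forces a = 0, and the face would be all of STAB(G).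
  facet-rhs≢0 : ∀ {a β} → (∀ i → 0ℚ ≤ a i) → FacetSTAB (adj G) a β → β ≢ 0ℚ
  facet-rhs≢0 {a} {β} a≥0 (valid , r , ((q , q∈STAB , q-indep) , _) , (_ , face-bound)) β≡0 =
    ℕP.<-irrefl refl (face-bound (suc r) q (λ j → q∈STAB j , on-face j) q-indep)
    where
    a≡0 : ∀ u → a u ≡ 0ℚ
    a≡0 u = ℚP.≤-antisym
      (subst₂ _≤_ (dot-χ⁅⁆ a u) β≡0 (valid (χ ⁅ u ⁆) (χ∈STAB (⁅⁆-stable u)))) (a≥0 u)
    on-face : ∀ j → dot a (q j) ≡ β
    on-face j = begin
      dot a (q j)                 ≡⟨ sumF-cong (λ i → trans (cong (_* q j i) (a≡0 i)) (ℚP.*-zeroˡ (q j i))) ⟩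
      sumF {m} (const 0ℚ)         ≡⟨ sumF-zero m ⟩
      0ℚ                          ≡⟨ sym β≡0 ⟩
      β                           ∎

-- The stretched graph

-- A vector on V(H) is written P ∘ kind v with P : Kind n → ℚ; the value P (old v) is never read.
module Kinds {n} (v : Fin n) where

  open ≡-Reasoning

  vertex : Kind n → Fin (n ℕ.+ 2)
  vertex (old i) = i ↑ˡ 2
  vertex k0      = v ↑ˡ 2
  vertex k1      = n ↑ʳ zero
  vertex k2      = n ↑ʳ suc zero

  v₀ v₁ v₂ : Fin (n ℕ.+ 2)
  v₀ = vertex k0
  v₁ = vertex k1
  v₂ = vertex k2

  vertex-kind : ∀ x → vertex (kind v x) ≡ x
  vertex-kind x with Fin.splitAt n x in eq
  ... | inj₁ i with i FinP.≟ v
  ...   | yes refl = trans (cong (Fin.join n 2) (sym eq)) (FinP.join-splitAt n 2 x)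
  ...   | no _     = trans (cong (Fin.join n 2) (sym eq)) (FinP.join-splitAt n 2 x)
  vertex-kind x | inj₂ zero       = trans (cong (Fin.join n 2) (sym eq)) (FinP.join-splitAt n 2 x)
  vertex-kind x | inj₂ (suc zero) = trans (cong (Fin.join n 2) (sym eq)) (FinP.join-splitAt n 2 x)

  kind-old : ∀ i → i ≢ v → kind v (i ↑ˡ 2) ≡ old i
  kind-old i i≢v rewrite FinP.splitAt-↑ˡ n i 2 with i FinP.≟ v
  ... | yes i≡v = contradiction i≡v i≢v
  ... | no _    = refl

  kind-v₀ : kind v v₀ ≡ k0
  kind-v₀ rewrite FinP.splitAt-↑ˡ n v 2 with v FinP.≟ v
  ... | yes _   = refl
  ... | no v≢v  = contradiction refl v≢v

  kind-v₁ : kind v v₁ ≡ k1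
  kind-v₁ rewrite FinP.splitAt-↑ʳ n 2 zero = refl

  kind-v₂ : kind v v₂ ≡ k2
  kind-v₂ rewrite FinP.splitAt-↑ʳ n 2 (suc zero) = refl

  old≢old : ∀ {i} → i ≢ v → old i ≢ old v
  old≢old i≢v refl = i≢v refl

  kind-vertex : ∀ K → K ≢ old v → kind v (vertex K) ≡ K
  kind-vertex (old i) K≢ = kind-old i (λ { refl → K≢ refl })
  kind-vertex k0      _  = kind-v₀
  kind-vertex k1      _  = kind-v₁
  kind-vertex k2      _  = kind-v₂

  sumF-kind : (F : Kind n → ℚ) (y : Fin n → ℚ) → (∀ i → i ≢ v → y i ≡ F (old i)) →
    sumF (F ∘ kind v) + y v ≡ ((sumF y + F k0) + F k1) + F k2
  sumF-kind F y y≗F = begin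
    sumF (F ∘ kind v) + y v
      ≡⟨ cong (_+ y v) (sumF-↑ {n} {2} (F ∘ kind v)) ⟩
    (sumF (F ∘ kind v ∘ (_↑ˡ 2)) + (F (kind v v₁) + (F (kind v v₂) + 0ℚ))) + y v
      ≡⟨ move-y (sumF (F ∘ kind v ∘ (_↑ˡ 2))) (F (kind v v₁) + (F (kind v v₂) + 0ℚ)) (y v) ⟩
    (sumF (F ∘ kind v ∘ (_↑ˡ 2)) + y v) + (F (kind v v₁) + (F (kind v v₂) + 0ℚ))
      ≡⟨ cong₂ _+_ (sumF-update v (F ∘ kind v ∘ (_↑ˡ 2)) y old≗y)
                   (cong₂ (λ K L → F K + (F L + 0ℚ)) kind-v₁ kind-v₂) ⟩
    (sumF y + F (kind v v₀)) + (F k1 + (F k2 + 0ℚ))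
      ≡⟨ cong (λ K → (sumF y + F K) + (F k1 + (F k2 + 0ℚ))) kind-v₀ ⟩
    (sumF y + F k0) + (F k1 + (F k2 + 0ℚ))
      ≡⟨ reassociate (sumF y + F k0) (F k1) (F k2) ⟩
    ((sumF y + F k0) + F k1) + F k2
      ∎
    where
    old≗y : ∀ i → i ≢ v → F (kind v (i ↑ˡ 2)) ≡ y i
    old≗y i i≢v = trans (cong F (kind-old i i≢v)) (sym (y≗F i i≢v))
    move-y : ∀ s t y → (s + t) + y ≡ (s + y) + t
    move-y = solve-∀ ℚ-ring
    reassociate : ∀ s x y → s + (x + (y + 0ℚ)) ≡ (s + x) + y
    reassociate = solve-∀ ℚ-ring

_∖_ : ∀ {n} → VSet n → VSet n → VSet n
(U ∖ B) i = not (B i) ∧ U i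

∖-true : ∀ {n} (U B : VSet n) i → (U ∖ B) i ≡ true → B i ≡ false × U i ≡ true
∖-true U B i U∖B∋i with B i
... | false = refl , U∖B∋i
... | true  = contradiction U∖B∋i λ ()

⊆-false : ∀ {n} {A B : VSet n} → Subset⊆ A B → ∀ i → B i ≡ false → A i ≡ false
⊆-false {A = A} A⊆B i B∌i with A i in A∋i
... | false = refl
... | true  = trans (sym (A⊆B i A∋i)) B∌i

stretch-system-trivial : ∀ (l₁ l₂ s w : ℚ) →
  l₁ + (l₂ + s) ≡ 0ℚ → s - w ≡ 0ℚ → l₂ + w ≡ 0ℚ → l₁ + w ≡ 0ℚ →
  (l₁ ≡ 0ℚ × l₂ ≡ 0ℚ) × (s ≡ 0ℚ × w ≡ 0ℚ)
stretch-system-trivial l₁ l₂ s w Σ≡0 s-w≡0 l₂+w≡0 l₁+w≡0 =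
  (cancel-w l₁ l₁+w≡0 , cancel-w l₂ l₂+w≡0) , (trans (p-q≡0⇒p≡q s w s-w≡0) w≡0 , w≡0)
  where
  open ≡-Reasoning
  w≡0 : w ≡ 0ℚ
  w≡0 = begin
    w
      ≡⟨ eliminate l₁ l₂ s w ⟩
    (((s - w) + (l₂ + w)) + (l₁ + w)) - (l₁ + (l₂ + s))
      ≡⟨ cong₂ _-_ (cong₂ _+_ (cong₂ _+_ s-w≡0 l₂+w≡0) l₁+w≡0) Σ≡0 ⟩
    ((0ℚ + 0ℚ) + 0ℚ) - 0ℚ
      ≡⟨⟩
    0ℚ
      ∎
    where
    eliminate : ∀ x y s w → w ≡ (((s - w) + (y + w)) + (x + w)) - (x + (y + s))
    eliminate = solve-∀ ℚ-ring
  cancel-w : ∀ l → l + w ≡ 0ℚ → l ≡ 0ℚ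
  cancel-w l l+w≡0 = trans (sym (ℚP.+-identityʳ l)) (trans (cong (l +_) (sym w≡0)) l+w≡0)

module Stretching {n} (G : Graph n) (v : Fin n) (A₁ A₂ : VSet n) (sd : StretchData G v A₁ A₂) where

  open Kinds v public
  open ≡-Reasoning

  E : Adj n
  E = adj G

  H : Adj (n ℕ.+ 2)
  H = stretch G v A₁ A₂

  adjK : Kind n → Kind n → Bool
  adjK = stretchAdjK E A₁ A₂

  A₁⊆Γv : Subset⊆ A₁ (E v)
  A₁⊆Γv = proj₁ (proj₁ sd)

  A₂⊆Γv : Subset⊆ A₂ (E v)
  A₂⊆Γv = proj₁ (proj₁ (proj₂ sd))

  A₁∪A₂≡Γv : ∀ i → (A₁ i ∨ A₂ i) ≡ E v i
  A₁∪A₂≡Γv = proj₂ (proj₂ sd)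

  IsStableK : (Kind n → Bool) → Set
  IsStableK T = ∀ K L → T K ≡ true → T L ≡ true → adjK K L ≡ false

  stable-kinds : ∀ {S} → IsStable H S → ∀ K L → K ≢ old v → L ≢ old v →
    S (vertex K) ≡ true → S (vertex L) ≡ true → adjK K L ≡ false
  stable-kinds S-stable K L K≢ L≢ S∋K S∋L =
    subst₂ (λ K′ L′ → adjK K′ L′ ≡ false) (kind-vertex K K≢) (kind-vertex L L≢)
      (S-stable (vertex K) (vertex L) S∋K S∋L)

  stretchedSet : VSet n → Kind n → Bool
  stretchedSet U (old i) = U i
  stretchedSet U k0      = not (U v)
  stretchedSet U k1      = U v
  stretchedSet U k2      = U v

  stretchedSet-stable : ∀ {U} → IsStable E U → IsStableK (stretchedSet U)
  stretchedSet-stable U-stable (old i) (old j) U∋i U∋j = U-stable i j U∋i U∋j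
  stretchedSet-stable U-stable (old i) k1 U∋i U∋v = ⊆-false A₁⊆Γv i (U-stable v i U∋v U∋i)
  stretchedSet-stable U-stable (old i) k2 U∋i U∋v = ⊆-false A₂⊆Γv i (U-stable v i U∋v U∋i)
  stretchedSet-stable U-stable k1 (old j) U∋v U∋j = ⊆-false A₁⊆Γv j (U-stable v j U∋v U∋j)
  stretchedSet-stable U-stable k2 (old j) U∋v U∋j = ⊆-false A₂⊆Γv j (U-stable v j U∋v U∋j)
  stretchedSet-stable U-stable k0 k1 U∌v U∋v = contradiction (sym U∌v) (not-¬ (sym U∋v))
  stretchedSet-stable U-stable k0 k2 U∌v U∋v = contradiction (sym U∌v) (not-¬ (sym U∋v))
  stretchedSet-stable U-stable k1 k0 U∋v U∌v = contradiction (sym U∌v) (not-¬ (sym U∋v))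
  stretchedSet-stable U-stable k2 k0 U∋v U∌v = contradiction (sym U∌v) (not-¬ (sym U∋v))
  stretchedSet-stable U-stable (old i) k0 _ _ = refl
  stretchedSet-stable U-stable k0 (old j) _ _ = refl
  stretchedSet-stable U-stable k0 k0 _ _ = refl
  stretchedSet-stable U-stable k1 k1 _ _ = refl
  stretchedSet-stable U-stable k1 k2 _ _ = refl
  stretchedSet-stable U-stable k2 k1 _ _ = refl
  stretchedSet-stable U-stable k2 k2 _ _ = refl

  -- Removing A_ℓ keeps every lifted set stable, without showing that the sets of positive weight
  -- already avoid A_ℓ.
  tip₁ tip₂ : VSet n → Kind n → Bool
  tip₁ U (old i) = (U ∖ A₁) i
  tip₁ U k1      = true
  tip₁ U _       = false
  tip₂ U (old i) = (U ∖ A₂) i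
  tip₂ U k2      = true
  tip₂ U _       = false

  tip₁-stable : ∀ {U} → IsStable E U → IsStableK (tip₁ U)
  tip₁-stable {U} U-stable (old i) (old j) p q =
    U-stable i j (proj₂ (∖-true U A₁ i p)) (proj₂ (∖-true U A₁ j q))
  tip₁-stable {U} U-stable (old i) k1 p _ = proj₁ (∖-true U A₁ i p)
  tip₁-stable {U} U-stable k1 (old j) _ q = proj₁ (∖-true U A₁ j q)
  tip₁-stable {U} U-stable k1 k1 _ _ = refl
  tip₁-stable {U} U-stable (old i) k0 _ ()
  tip₁-stable {U} U-stable (old i) k2 _ ()
  tip₁-stable {U} U-stable k1 k0 _ ()
  tip₁-stable {U} U-stable k1 k2 _ ()
  tip₁-stable {U} U-stable k0 _ () _
  tip₁-stable {U} U-stable k2 _ () _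

  tip₂-stable : ∀ {U} → IsStable E U → IsStableK (tip₂ U)
  tip₂-stable {U} U-stable (old i) (old j) p q =
    U-stable i j (proj₂ (∖-true U A₂ i p)) (proj₂ (∖-true U A₂ j q))
  tip₂-stable {U} U-stable (old i) k2 p _ = proj₁ (∖-true U A₂ i p)
  tip₂-stable {U} U-stable k2 (old j) _ q = proj₁ (∖-true U A₂ j q)
  tip₂-stable {U} U-stable k2 k2 _ _ = refl
  tip₂-stable {U} U-stable (old i) k0 _ ()
  tip₂-stable {U} U-stable (old i) k1 _ ()
  tip₂-stable {U} U-stable k2 k0 _ ()
  tip₂-stable {U} U-stable k2 k1 _ ()
  tip₂-stable {U} U-stable k0 _ () _
  tip₂-stable {U} U-stable k1 _ () _

  stretchedVec : Vec' n → Kind n → ℚ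
  stretchedVec y (old i) = y i
  stretchedVec y k0      = 1ℚ - y v
  stretchedVec y k1      = y v
  stretchedVec y k2      = y v

  tipVec₁ tipVec₂ : Vec' n → Kind n → ℚ
  tipVec₁ y (old i) = y i
  tipVec₁ y k1      = 1ℚ
  tipVec₁ y _       = 0ℚ
  tipVec₂ y (old i) = y i
  tipVec₂ y k2      = 1ℚ
  tipVec₂ y _       = 0ℚ

  stretchedVec∈STAB : ∀ {y} → InSTAB E y → InSTAB H (stretchedVec y ∘ kind v)
  stretchedVec∈STAB {y} (k , U , μ , U-stable , μ≥0 , Σμ≡1 , y≡) =
    k , (λ j → stretchedSet (U j) ∘ kind v) , μ ,
    (λ j x x′ → stretchedSet-stable (U-stable j) (kind v x) (kind v x′)) , μ≥0 , Σμ≡1 ,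
    coordinate ∘ kind v
    where
    coordinate : ∀ K → stretchedVec y K ≡ sumF (λ j → μ j * 𝟙 (stretchedSet (U j) K))
    coordinate (old i) = y≡ i
    coordinate k0      = begin
      1ℚ - y v                                   ≡⟨ cong₂ _-_ (sym Σμ≡1) (y≡ v) ⟩
      sumF μ - sumF (λ j → μ j * 𝟙 (U j v))      ≡⟨ sym (sumF-*-complement μ _) ⟩
      sumF (λ j → μ j * (1ℚ - 𝟙 (U j v)))        ≡⟨ sumF-cong (λ j → cong (μ j *_) (sym (𝟙-not (U j v)))) ⟩
      sumF (λ j → μ j * 𝟙 (not (U j v)))         ∎
    coordinate k1      = y≡ v
    coordinate k2      = y≡ v

  tipVec₁∈STAB : ∀ {y} → STABAvoid G v A₁ y → InSTAB H (tipVec₁ y ∘ kind v)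
  tipVec₁∈STAB {y} ((k , U , μ , U-stable , μ≥0 , Σμ≡1 , y≡) , _ , y∣A₁≡0) =
    k , (λ j → tip₁ (U j) ∘ kind v) , μ ,
    (λ j x x′ → tip₁-stable (U-stable j) (kind v x) (kind v x′)) , μ≥0 , Σμ≡1 ,
    coordinate ∘ kind v
    where
    coordinate : ∀ K → tipVec₁ y K ≡ sumF (λ j → μ j * 𝟙 (tip₁ (U j) K))
    coordinate (old i) with A₁ i in A₁∋i
    ... | true  = trans (y∣A₁≡0 i A₁∋i) (sym (sumF-*-0 μ))
    ... | false = y≡ i
    coordinate k0 = sym (sumF-*-0 μ)
    coordinate k1 = sym (trans (sumF-cong (ℚP.*-identityʳ ∘ μ)) Σμ≡1)
    coordinate k2 = sym (sumF-*-0 μ)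

  tipVec₂∈STAB : ∀ {y} → STABAvoid G v A₂ y → InSTAB H (tipVec₂ y ∘ kind v)
  tipVec₂∈STAB {y} ((k , U , μ , U-stable , μ≥0 , Σμ≡1 , y≡) , _ , y∣A₂≡0) =
    k , (λ j → tip₂ (U j) ∘ kind v) , μ ,
    (λ j x x′ → tip₂-stable (U-stable j) (kind v x) (kind v x′)) , μ≥0 , Σμ≡1 ,
    coordinate ∘ kind v
    where
    coordinate : ∀ K → tipVec₂ y K ≡ sumF (λ j → μ j * 𝟙 (tip₂ (U j) K))
    coordinate (old i) with A₂ i in A₂∋i
    ... | true  = trans (y∣A₂≡0 i A₂∋i) (sym (sumF-*-0 μ))
    ... | false = y≡ i
    coordinate k0 = sym (sumF-*-0 μ)
    coordinate k1 = sym (sumF-*-0 μ)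
    coordinate k2 = sym (trans (sumF-cong (ℚP.*-identityʳ ∘ μ)) Σμ≡1)

  liftedFamily : ∀ {k} → Vec' n → Vec' n → (Fin k → Vec' n) → Fin (suc (suc k)) → Kind n → ℚ
  liftedFamily y₁ y₂ p = tipVec₂ y₁ ∷ tipVec₁ y₂ ∷ stretchedVec ∘ p

  liftedFamily-affIndep : ∀ {k} (y₁ y₂ : Vec' n) (p : Fin k → Vec' n) → AffIndep p →
    AffIndep (λ j → liftedFamily y₁ y₂ p j ∘ kind v)
  liftedFamily-affIndep y₁ y₂ p p-indep λs Σλ≡0 λs∈ker = λ
    { zero             → l₁≡0
    ; (suc zero)       → l₂≡0
    ; (suc (suc j))    → p-indep λ′ s≡0 λ′∈ker j
    }
    where
    l₁ l₂ s w : ℚ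
    l₁ = λs zero
    l₂ = λs (suc zero)
    λ′ : Fin _ → ℚ
    λ′ j = λs (suc (suc j))
    s = sumF λ′
    w = sumF (λ j → λ′ j * p j v)

    at : ∀ K → K ≢ old v → sumF (λ j → λs j * liftedFamily y₁ y₂ p j K) ≡ 0ℚ
    at K K≢ = subst (λ L → sumF (λ j → λs j * liftedFamily y₁ y₂ p j L) ≡ 0ℚ)
                    (kind-vertex K K≢) (λs∈ker (vertex K))

    at-v₀ : s - w ≡ 0ℚ
    at-v₀ = begin
      s - w                                          ≡⟨ sym (sumF-*-complement λ′ _) ⟩
      sumF (λ j → λ′ j * (1ℚ - p j v))               ≡⟨ pad l₁ l₂ _ ⟩
      l₁ * 0ℚ + (l₂ * 0ℚ + sumF (λ j → λ′ j * (1ℚ - p j v)))  ≡⟨ at k0 (λ ()) ⟩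
      0ℚ                                             ∎
      where
      pad : ∀ x y t → t ≡ x * 0ℚ + (y * 0ℚ + t)
      pad = solve-∀ ℚ-ring
    at-v₁ : l₂ + w ≡ 0ℚ
    at-v₁ = trans (pad l₁ l₂ w) (at k1 (λ ()))
      where
      pad : ∀ x y t → y + t ≡ x * 0ℚ + (y * 1ℚ + t)
      pad = solve-∀ ℚ-ring
    at-v₂ : l₁ + w ≡ 0ℚ
    at-v₂ = trans (pad l₁ l₂ w) (at k2 (λ ()))
      where
      pad : ∀ x y t → x + t ≡ x * 1ℚ + (y * 0ℚ + t)
      pad = solve-∀ ℚ-ring

    solution : (l₁ ≡ 0ℚ × l₂ ≡ 0ℚ) × (s ≡ 0ℚ × w ≡ 0ℚ)
    solution = stretch-system-trivial l₁ l₂ s w Σλ≡0 at-v₀ at-v₁ at-v₂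
    l₁≡0 : l₁ ≡ 0ℚ
    l₁≡0 = proj₁ (proj₁ solution)
    l₂≡0 : l₂ ≡ 0ℚ
    l₂≡0 = proj₂ (proj₁ solution)
    s≡0 : s ≡ 0ℚ
    s≡0 = proj₁ (proj₂ solution)
    w≡0 : w ≡ 0ℚ
    w≡0 = proj₂ (proj₂ solution)

    λ′∈ker : ∀ i → sumF (λ j → λ′ j * p j i) ≡ 0ℚ
    λ′∈ker i with i FinP.≟ v
    ... | yes refl = w≡0
    ... | no i≢v   = begin
      Σi                                  ≡⟨ pad (y₁ i) (y₂ i) Σi ⟩
      0ℚ * y₁ i + (0ℚ * y₂ i + Σi)        ≡⟨ cong₂ (λ x y → x * y₁ i + (y * y₂ i + Σi)) (sym l₁≡0) (sym l₂≡0) ⟩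
      l₁ * y₁ i + (l₂ * y₂ i + Σi)        ≡⟨ at (old i) (old≢old i≢v) ⟩
      0ℚ                                  ∎
      where
      Σi : ℚ
      Σi = sumF (λ j → λ′ j * p j i)
      pad : ∀ a b t → t ≡ 0ℚ * a + (0ℚ * b + t)
      pad = solve-∀ ℚ-ring

  module Trace (S : VSet (n ℕ.+ 2)) (S-stable : IsStable H S) where

    -- Entry v of λ i → S (i ↑ˡ 2) records v₀, so it is overwritten by b.
    old-part : Bool → VSet n
    old-part b = updateAt (λ i → S (i ↑ˡ 2)) v (const b)

    old-part-at-v : ∀ b → old-part b v ≡ b
    old-part-at-v b = updateAt-updates v (λ i → S (i ↑ˡ 2))

    old-part-off-v : ∀ b i → i ≢ v → old-part b i ≡ S (vertex (old i))
    old-part-off-v b i i≢v = updateAt-minimal i v (λ i → S (i ↑ˡ 2)) i≢v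

    old-part-cases : ∀ {b} i → old-part b i ≡ true →
      (i ≡ v × b ≡ true) ⊎ (i ≢ v × S (vertex (old i)) ≡ true)
    old-part-cases i i∈ with i FinP.≟ v
    ... | yes refl = inj₁ (refl , trans (sym (old-part-at-v _)) i∈)
    ... | no i≢v   = inj₂ (i≢v , trans (sym (old-part-off-v _ i i≢v)) i∈)

    old-part-stable : ∀ b → (b ≡ true → ∀ j → j ≢ v → S (vertex (old j)) ≡ true → E v j ≡ false) →
      IsStable E (old-part b)
    old-part-stable b v-isolated i j i∈ j∈ with old-part-cases i i∈ | old-part-cases j j∈
    ... | inj₁ (refl , _)     | inj₁ (refl , _)     = irrefl G v
    ... | inj₁ (refl , b≡t)   | inj₂ (j≢v , S∋j)    = v-isolated b≡t j j≢v S∋j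
    ... | inj₂ (i≢v , S∋i)    | inj₁ (refl , b≡t)   = trans (Graph.sym G i v) (v-isolated b≡t i i≢v S∋i)
    ... | inj₂ (i≢v , S∋i)    | inj₂ (j≢v , S∋j)    =
      stable-kinds S-stable (old i) (old j) (old≢old i≢v) (old≢old j≢v) S∋i S∋j

    v-isolated : S v₁ ≡ true → S v₂ ≡ true →
      ∀ j → j ≢ v → S (vertex (old j)) ≡ true → E v j ≡ false
    v-isolated S∋v₁ S∋v₂ j j≢v S∋j = trans (sym (A₁∪A₂≡Γv j))
      (cong₂ _∨_ (stable-kinds S-stable (old j) k1 (old≢old j≢v) (λ ()) S∋j S∋v₁)
                 (stable-kinds S-stable (old j) k2 (old≢old j≢v) (λ ()) S∋j S∋v₂))

    old-part-avoids : ∀ K → K ≢ old v → S (vertex K) ≡ true →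
      ∀ i → adjK (old i) K ≡ true → old-part false i ≡ false
    old-part-avoids K K≢ S∋K i i~K with old-part false i in i∈
    ... | false = refl
    ... | true with old-part-cases i i∈
    ...   | inj₂ (i≢v , S∋i) =
      contradiction (trans (sym i~K) (stable-kinds S-stable (old i) K (old≢old i≢v) K≢ S∋i S∋K)) λ ()

    old-part∈STAB : InSTAB E (χ (old-part false))
    old-part∈STAB = χ∈STAB (old-part-stable false λ ())

    old-part-avoid₁ : S v₁ ≡ true → STABAvoid G v A₁ (χ (old-part false))
    old-part-avoid₁ S∋v₁ = old-part∈STAB , cong 𝟙 (old-part-at-v false) ,
      λ i A₁∋i → cong 𝟙 (old-part-avoids k1 (λ ()) S∋v₁ i A₁∋i)

    old-part-avoid₂ : S v₂ ≡ true → STABAvoid G v A₂ (χ (old-part false))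
    old-part-avoid₂ S∋v₂ = old-part∈STAB , cong 𝟙 (old-part-at-v false) ,
      λ i A₂∋i → cong 𝟙 (old-part-avoids k2 (λ ()) S∋v₂ i A₂∋i)

    old-part-with-v∈STAB : S v₁ ≡ true → S v₂ ≡ true → InSTAB E (χ (old-part true))
    old-part-with-v∈STAB S∋v₁ S∋v₂ = χ∈STAB (old-part-stable true λ _ → v-isolated S∋v₁ S∋v₂)

    dot-old-part-with-v : ∀ a → dot a (χ (old-part true)) ≡ dot a (χ (old-part false)) + a v
    dot-old-part-with-v a = +-cancelʳ (a v * 0ℚ) (dot a (χ (old-part true))) (dot a (χ (old-part false)) + a v) (begin
      dot a (χ (old-part true)) + a v * 0ℚ
        ≡⟨ cong (λ b → dot a (χ (old-part true)) + a v * 𝟙 b) (sym (old-part-at-v false)) ⟩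
      dot a (χ (old-part true)) + a v * χ (old-part false) v
        ≡⟨ sumF-update v (λ i → a i * χ (old-part true) i) (λ i → a i * χ (old-part false) i) agree ⟩
      dot a (χ (old-part false)) + a v * χ (old-part true) v
        ≡⟨ cong (λ b → dot a (χ (old-part false)) + a v * 𝟙 b) (old-part-at-v true) ⟩
      dot a (χ (old-part false)) + a v * 1ℚ
        ≡⟨ shift (dot a (χ (old-part false))) (a v) ⟩
      (dot a (χ (old-part false)) + a v) + a v * 0ℚ
        ∎)
      where
      agree : ∀ i → i ≢ v → a i * χ (old-part true) i ≡ a i * χ (old-part false) i
      agree i i≢v = cong (λ b → a i * 𝟙 b)
        (trans (old-part-off-v true i i≢v) (sym (old-part-off-v false i i≢v)))
      shift : ∀ t x → t + x * 1ℚ ≡ (t + x) + x * 0ℚ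
      shift = solve-∀ ℚ-ring

module Inequality {n} (G : Graph n) (v : Fin n) (A₁ A₂ : VSet n) (sd : StretchData G v A₁ A₂)
                  (a : Vec' n) (β m₁ m₂ : ℚ) where

  open Stretching G v A₁ A₂ sd

  d₁ d₂ e₀ β′ : ℚ
  d₁ = (a v - β) + m₁
  d₂ = (a v - β) + m₂
  e₀ = (d₁ + d₂) - a v
  β′ = ((β - a v) + d₁) + d₂

  c : Vec' (n ℕ.+ 2)
  c = newCoeff v a d₁ d₂

  dot-c : ∀ (P : Kind n → ℚ) (y : Vec' n) → (∀ i → i ≢ v → y i ≡ P (old i)) →
    dot c (P ∘ kind v) + a v * y v ≡ ((dot a y + e₀ * P k0) + d₁ * P k1) + d₂ * P k2
  dot-c P y y≗P = sumF-kind (λ K → newCoeffK a (a v) d₁ d₂ K * P K) (λ i → a i * y i)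
                            (λ i i≢v → cong (a i *_) (y≗P i i≢v))

  dot-c-avoiding-v : ∀ (P : Kind n → ℚ) (y : Vec' n) → (∀ i → i ≢ v → y i ≡ P (old i)) → y v ≡ 0ℚ →
    dot c (P ∘ kind v) ≡ ((dot a y + e₀ * P k0) + d₁ * P k1) + d₂ * P k2
  dot-c-avoiding-v P y y≗P y∌v = begin
    dot c (P ∘ kind v)                ≡⟨ sym (ℚP.+-identityʳ _) ⟩
    dot c (P ∘ kind v) + 0ℚ           ≡⟨ cong (dot c (P ∘ kind v) +_) (sym (trans (cong (a v *_) y∌v) (ℚP.*-zeroʳ (a v)))) ⟩
    dot c (P ∘ kind v) + a v * y v    ≡⟨ dot-c P y y≗P ⟩
    _                                 ∎
    where open ≡-Reasoning

  β′≡β+e₀ : β′ ≡ β + e₀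
  β′≡β+e₀ = identity β (a v) d₁ d₂
    where
    identity : ∀ b av x y → ((b - av) + x) + y ≡ b + ((x + y) - av)
    identity = solve-∀ ℚ-ring

  β′≡m₁+d₂ : β′ ≡ m₁ + d₂
  β′≡m₁+d₂ = identity β (a v) m₁ d₂
    where
    identity : ∀ b av m y → ((b - av) + ((av - b) + m)) + y ≡ m + y
    identity = solve-∀ ℚ-ring

  β′≡m₂+d₁ : β′ ≡ m₂ + d₁
  β′≡m₂+d₁ = identity β (a v) d₁ m₂
    where
    identity : ∀ b av x m → ((b - av) + x) + ((av - b) + m) ≡ m + x
    identity = solve-∀ ℚ-ring

  β≤β′ : a v ≤ d₁ + d₂ → β ≤ β′
  β≤β′ av≤d₁+d₂ = let open ℚP.≤-Reasoning in begin
    β                          ≡⟨ identity β (a v) ⟩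
    (β - a v) + a v            ≤⟨ ℚP.+-monoʳ-≤ (β - a v) av≤d₁+d₂ ⟩
    (β - a v) + (d₁ + d₂)      ≡⟨ sym (ℚP.+-assoc (β - a v) d₁ d₂) ⟩
    β′                         ∎
    where
    identity : ∀ b av → b ≡ (b - av) + av
    identity = solve-∀ ℚ-ring

  β′≢0 : 0ℚ ≤ β → β ≢ 0ℚ → a v ≤ d₁ + d₂ → β′ ≢ 0ℚ
  β′≢0 0≤β β≢0 av≤d₁+d₂ β′≡0 = β≢0 (ℚP.≤-antisym (subst (β ≤_) β′≡0 (β≤β′ av≤d₁+d₂)) 0≤β)

  only-v₁ : ∀ t → ((t + e₀ * 0ℚ) + d₁ * 1ℚ) + d₂ * 0ℚ ≡ t + d₁
  only-v₁ t = identity t e₀ d₁ d₂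
    where
    identity : ∀ t e x y → ((t + e * 0ℚ) + x * 1ℚ) + y * 0ℚ ≡ t + x
    identity = solve-∀ ℚ-ring

  only-v₂ : ∀ t → ((t + e₀ * 0ℚ) + d₁ * 0ℚ) + d₂ * 1ℚ ≡ t + d₂
  only-v₂ t = identity t e₀ d₁ d₂
    where
    identity : ∀ t e x y → ((t + e * 0ℚ) + x * 0ℚ) + y * 1ℚ ≡ t + y
    identity = solve-∀ ℚ-ring

  dot-c-χ : ∀ S (S-stable : IsStable H S) → let open Trace S S-stable in
    dot c (χ S) ≡ ((dot a (χ (old-part false)) + e₀ * 𝟙 (S v₀)) + d₁ * 𝟙 (S v₁)) + d₂ * 𝟙 (S v₂)
  dot-c-χ S S-stable = trans
    (sumF-cong (λ x → cong (λ x′ → c x * 𝟙 (S x′)) (sym (vertex-kind x))))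
    (dot-c-avoiding-v (𝟙 ∘ S ∘ vertex) (χ (old-part false))
      (λ i i≢v → cong 𝟙 (old-part-off-v false i i≢v)) (cong 𝟙 (old-part-at-v false)))
    where open Trace S S-stable

  module Validity (valid : ValidSTAB E a β)
                  (≤m₁ : ∀ y → STABAvoid G v A₂ y → dot a y ≤ m₁)
                  (≤m₂ : ∀ y → STABAvoid G v A₁ y → dot a y ≤ m₂)
                  (av≤d₁+d₂ : a v ≤ d₁ + d₂) where

    valid-on-stable : ∀ S → IsStable H S → dot c (χ S) ≤ β′
    valid-on-stable S S-stable = begin
      dot c (χ S)                                                ≡⟨ dot-c-χ S S-stable ⟩
      ((aT + e₀ * 𝟙 (S v₀)) + d₁ * 𝟙 (S v₁)) + d₂ * 𝟙 (S v₂)    ≤⟨ by-cases (S v₀) (S v₁) (S v₂) refl refl refl ⟩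
      β′                                                         ∎
      where
      open ℚP.≤-Reasoning
      open Trace S S-stable
      aT : ℚ
      aT = dot a (χ (old-part false))
      by-cases : ∀ b₀ b₁ b₂ → S v₀ ≡ b₀ → S v₁ ≡ b₁ → S v₂ ≡ b₂ →
        ((aT + e₀ * 𝟙 b₀) + d₁ * 𝟙 b₁) + d₂ * 𝟙 b₂ ≤ β′
      by-cases true true _ S∋v₀ S∋v₁ _ =
        contradiction (stable-kinds S-stable k0 k1 (λ ()) (λ ()) S∋v₀ S∋v₁) λ ()
      by-cases true false true S∋v₀ _ S∋v₂ =
        contradiction (stable-kinds S-stable k0 k2 (λ ()) (λ ()) S∋v₀ S∋v₂) λ ()
      by-cases true false false _ _ _ = begin
        ((aT + e₀ * 1ℚ) + d₁ * 0ℚ) + d₂ * 0ℚ   ≡⟨ only-v₀ aT e₀ d₁ d₂ ⟩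
        aT + e₀                                ≤⟨ ℚP.+-monoˡ-≤ e₀ (valid _ old-part∈STAB) ⟩
        β + e₀                                 ≡⟨ sym β′≡β+e₀ ⟩
        β′                                     ∎
        where
        only-v₀ : ∀ t e x y → ((t + e * 1ℚ) + x * 0ℚ) + y * 0ℚ ≡ t + e
        only-v₀ = solve-∀ ℚ-ring
      by-cases false false false _ _ _ = begin
        ((aT + e₀ * 0ℚ) + d₁ * 0ℚ) + d₂ * 0ℚ   ≡⟨ none aT e₀ d₁ d₂ ⟩
        aT                                     ≤⟨ valid _ old-part∈STAB ⟩
        β                                      ≤⟨ β≤β′ av≤d₁+d₂ ⟩
        β′                                     ∎
        where
        none : ∀ t e x y → ((t + e * 0ℚ) + x * 0ℚ) + y * 0ℚ ≡ t
        none = solve-∀ ℚ-ring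
      by-cases false true false _ S∋v₁ _ = begin
        ((aT + e₀ * 0ℚ) + d₁ * 1ℚ) + d₂ * 0ℚ   ≡⟨ only-v₁ aT ⟩
        aT + d₁                                ≤⟨ ℚP.+-monoˡ-≤ d₁ (≤m₂ _ (old-part-avoid₁ S∋v₁)) ⟩
        m₂ + d₁                                ≡⟨ sym β′≡m₂+d₁ ⟩
        β′                                     ∎
      by-cases false false true _ _ S∋v₂ = begin
        ((aT + e₀ * 0ℚ) + d₁ * 0ℚ) + d₂ * 1ℚ   ≡⟨ only-v₂ aT ⟩
        aT + d₂                                ≤⟨ ℚP.+-monoˡ-≤ d₂ (≤m₁ _ (old-part-avoid₂ S∋v₂)) ⟩
        m₁ + d₂                                ≡⟨ sym β′≡m₁+d₂ ⟩
        β′                                     ∎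
      by-cases false true true _ S∋v₁ S∋v₂ = begin
        ((aT + e₀ * 0ℚ) + d₁ * 1ℚ) + d₂ * 1ℚ   ≡⟨ v₁-and-v₂ aT (a v) d₁ d₂ ⟩
        (aT + a v) + e₀                        ≡⟨ cong (_+ e₀) (sym (dot-old-part-with-v a)) ⟩
        dot a (χ (old-part true)) + e₀         ≤⟨ ℚP.+-monoˡ-≤ e₀ (valid _ (old-part-with-v∈STAB S∋v₁ S∋v₂)) ⟩
        β + e₀                                 ≡⟨ sym β′≡β+e₀ ⟩
        β′                                     ∎
        where
        v₁-and-v₂ : ∀ t av x y → ((t + ((x + y) - av) * 0ℚ) + x * 1ℚ) + y * 1ℚ ≡ (t + av) + ((x + y) - av)
        v₁-and-v₂ = solve-∀ ℚ-ring

    stretched-valid : ValidSTAB H c β′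
    stretched-valid = ValidSTAB-from-stable {c = c} valid-on-stable

  tipVec₁-value : ∀ {y} → y v ≡ 0ℚ → dot a y ≡ m₂ → dot c (tipVec₁ y ∘ kind v) ≡ β′
  tipVec₁-value {y} y∌v ay≡m₂ = begin
    dot c (tipVec₁ y ∘ kind v)                   ≡⟨ dot-c-avoiding-v (tipVec₁ y) y (λ _ _ → refl) y∌v ⟩
    ((dot a y + e₀ * 0ℚ) + d₁ * 1ℚ) + d₂ * 0ℚ    ≡⟨ only-v₁ (dot a y) ⟩
    dot a y + d₁                                 ≡⟨ cong (_+ d₁) ay≡m₂ ⟩
    m₂ + d₁                                      ≡⟨ sym β′≡m₂+d₁ ⟩
    β′                                           ∎
    where open ≡-Reasoning

  tipVec₂-value : ∀ {y} → y v ≡ 0ℚ → dot a y ≡ m₁ → dot c (tipVec₂ y ∘ kind v) ≡ β′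
  tipVec₂-value {y} y∌v ay≡m₁ = begin
    dot c (tipVec₂ y ∘ kind v)                   ≡⟨ dot-c-avoiding-v (tipVec₂ y) y (λ _ _ → refl) y∌v ⟩
    ((dot a y + e₀ * 0ℚ) + d₁ * 0ℚ) + d₂ * 1ℚ    ≡⟨ only-v₂ (dot a y) ⟩
    dot a y + d₂                                 ≡⟨ cong (_+ d₂) ay≡m₁ ⟩
    m₁ + d₂                                      ≡⟨ sym β′≡m₁+d₂ ⟩
    β′                                           ∎
    where open ≡-Reasoning

  stretchedVec-value : ∀ {y} → dot a y ≡ β → dot c (stretchedVec y ∘ kind v) ≡ β′
  stretchedVec-value {y} ay≡β = +-cancelʳ (a v * y v) _ _ (begin
    dot c (stretchedVec y ∘ kind v) + a v * y v
      ≡⟨ dot-c (stretchedVec y) y (λ _ _ → refl) ⟩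
    ((dot a y + e₀ * (1ℚ - y v)) + d₁ * y v) + d₂ * y v
      ≡⟨ cong (λ t → ((t + e₀ * (1ℚ - y v)) + d₁ * y v) + d₂ * y v) ay≡β ⟩
    ((β + e₀ * (1ℚ - y v)) + d₁ * y v) + d₂ * y v
      ≡⟨ identity β (a v) d₁ d₂ (y v) ⟩
    β′ + a v * y v
      ∎)
    where
    open ≡-Reasoning
    identity : ∀ b av x y t →
      ((b + ((x + y) - av) * (1ℚ - t)) + x * t) + y * t ≡ (((b - av) + x) + y) + av * t
    identity = solve-∀ ℚ-ring

  liftedFamily∈face : ∀ {k y₁ y₂} {p : Fin k → Vec' n} →
    STABAvoid G v A₂ y₁ → dot a y₁ ≡ m₁ → STABAvoid G v A₁ y₂ → dot a y₂ ≡ m₂ →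
    (∀ j → FaceSTAB E a β (p j)) → ∀ j → FaceSTAB H c β′ (liftedFamily y₁ y₂ p j ∘ kind v)
  liftedFamily∈face y₁∈ ay₁≡m₁ _ _ _ zero =
    tipVec₂∈STAB y₁∈ , tipVec₂-value (proj₁ (proj₂ y₁∈)) ay₁≡m₁
  liftedFamily∈face _ _ y₂∈ ay₂≡m₂ _ (suc zero) =
    tipVec₁∈STAB y₂∈ , tipVec₁-value (proj₁ (proj₂ y₂∈)) ay₂≡m₂
  liftedFamily∈face _ _ _ _ p∈F (suc (suc j)) =
    stretchedVec∈STAB (proj₁ (p∈F j)) , stretchedVec-value (proj₂ (p∈F j))

corollary14 : ∀ {n} (G : Graph n) (v : Fin n) (A₁ A₂ : VSet n) →
    StretchData G v A₁ A₂ →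
    (a : Vec' n) (β : ℚ) → (∀ i → 0ℚ ≤ a i) → FacetSTAB (adj G) a β →
    (m₁ m₂ : ℚ) →
    IsMax (STABAvoid G v A₂) (dot a) m₁ →
    IsMax (STABAvoid G v A₁) (dot a) m₂ →
    let d₁ = (a v - β) + m₁
        d₂ = (a v - β) + m₂
    in a v ≤ d₁ + d₂ →
       FacetSTAB (stretch G v A₁ A₂) (newCoeff v a d₁ d₂) (((β - a v) + d₁) + d₂)
corollary14 {n} G v A₁ A₂ sd a β a≥0 facet m₁ m₂
            ((y₁ , y₁∈ , ay₁≡m₁) , ≤m₁) ((y₂ , y₂∈ , ay₂≡m₂) , ≤m₂) av≤d₁+d₂ =
  let p , p∈F , p-indep = facet-face-basis G {a} {β} facet in
  facet-criterion {c = c} stretched-valid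
    (β′≢0 (ValidSTAB⇒0≤rhs {c = a} (proj₁ facet)) (facet-rhs≢0 G a≥0 facet) av≤d₁+d₂)
    (λ j → liftedFamily y₁ y₂ p j ∘ kind v)
    (liftedFamily∈face y₁∈ ay₁≡m₁ y₂∈ ay₂≡m₂ p∈F)
    (liftedFamily-affIndep y₁ y₂ p p-indep)
    (ℕP.+-comm 2 n)
  where
  open Stretching G v A₁ A₂ sd
  open Inequality G v A₁ A₂ sd a β m₁ m₂
  open Validity (proj₁ facet) ≤m₁ ≤m₂ av≤d₁+d₂
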